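{- The formula schemas (1) $(\bigcirc\varphi\to\bigcirc\psi)\to\bigcirc(\varphi\to\psi)$ and (2) $(\Diamond\varphi\to\Box\psi)\to\Box(\varphi\to\psi)$ are not valid over the class of all models based on dynamic posets (i.e. each has an instance, with $\varphi,\psi$ formulas, that fails at some world of some such model). However, for all formulas $\varphi,\psi$, both (1) and (2) are valid over the class of persistent models.
   Context: Formulas are built from propositional variables, $\bot,\wedge,\vee,\to,\bigcirc,\Diamond,\Box,\mathcal U,\mathcal R$. A dynamic poset is $(W,\preccurlyeq,S)$ with $W\ne\emptyset$, $\preccurlyeq$ a partial order, $S:W\to W$ with $w\preccurlyeq v\Rightarrow S(w)\preccurlyeq S(v)$; it is persistent if moreover whenever $v\succcurlyeq S(w)$ there is $u\succcurlyeq w$ with $S(u)=v$. A model adds a valuation $V$ assigning each world a set of variables, with $w\preccurlyeq v\Rightarrow V(w)\subseteq V(v)$; a persistent model is a model on a persistent dynamic poset. Satisfaction: $w\models p$ iff $p\in V(w)$; $w\not\models\bot$; $\wedge,\vee$ classical; $w\models\varphi\to\psi$ iff for all $v\succcurlyeq w$, $v\models\varphi$ implies $v\models\psi$; $w\models\bigcirc\varphi$ iff $S(w)\models\varphi$; $w\models\Diamond\varphi$ iff $\exists k\ge0$, $S^k(w)\models\varphi$; $w\models\Box\varphi$ iff $\forall k\ge0$, $S^k(w)\models\varphi$; $w\models\varphi\,\mathcal U\,\psi$ iff $\exists k\ge0$ with $S^k(w)\models\psi$ and $S^i(w)\models\varphi$ for all $i<k$; $w\models\varphi\,\mathcal R\,\psi$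 iff for all $k\ge0$, $S^k(w)\models\psi$ or $S^i(w)\models\varphi$ for some $i<k$. Valid over a class means true at every world of every model in the class. -}

module Defs where

open import Data.Nat using (ℕ; zero; suc; _<_)
open import Data.Product using (Σ; _×_; _,_; ∃; ∃-syntax)
open import Data.Sum using (_⊎_)
open import Data.Empty using (⊥)
open import Relation.Nullary using (¬_)
open import Relation.Binary.PropositionalEquality using (_≡_)
open import Relation.Binary.Structures using (IsPartialOrder)

data Form : Set where
  var  : ℕ → Form
  ⊥'   : Form
  _∧'_ : Form → Form → Form
  _∨'_ : Form → Form → Form
  _⇒_  : Form → Form → Form
  ○_   : Form → Form
  ◇_   : Form → Form
  □_   : Form → Form
  _𝒰_  : Form → Form → Form
  _ℛ_  : Form → Form → Form

infixr 4 _⇒_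
infixr 6 _∧'_ _∨'_
infix 8 ○_ ◇_ □_

iter : {W : Set} → (W → W) → ℕ → W → W
iter S zero    w = w
iter S (suc k) w = S (iter S k w)

record DynPoset : Set₁ where
  field
    W       : Set
    inhabit : W
    _≼_     : W → W → Set
    isPO    : IsPartialOrder _≡_ _≼_
    S       : W → W
    S-mono  : ∀ {w v} → w ≼ v → S w ≼ S v

Persistent : DynPoset → Set
Persistent D = ∀ w v → S w ≼ v → ∃[ u ] (w ≼ u × S u ≡ v)
  where open DynPoset D

record Model : Set₁ where
  field
    frame  : DynPoset
  open DynPoset frame public
  field
    V      : W → ℕ → Set
    V-mono : ∀ {w v} p → w ≼ v → V w p → V v p

module _ (M : Model) where
  open Model M

  infix 3 _⊨_
  _⊨_ : W → Form → Set
  w ⊨ var p   = V w p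
  w ⊨ ⊥'      = ⊥
  w ⊨ φ ∧' ψ  = (w ⊨ φ) × (w ⊨ ψ)
  w ⊨ φ ∨' ψ  = (w ⊨ φ) ⊎ (w ⊨ ψ)
  w ⊨ φ ⇒ ψ   = ∀ v → w ≼ v → v ⊨ φ → v ⊨ ψ
  w ⊨ ○ φ     = S w ⊨ φ
  w ⊨ ◇ φ     = ∃[ k ] (iter S k w ⊨ φ)
  w ⊨ □ φ     = ∀ k → iter S k w ⊨ φ
  w ⊨ φ 𝒰 ψ   = ∃[ k ] ((iter S k w ⊨ ψ) × (∀ i → i < k → iter S i w ⊨ φ))
  w ⊨ φ ℛ ψ   = ∀ k → (iter S k w ⊨ ψ) ⊎ ∃[ i ] (i < k × iter S i w ⊨ φ)

ValidPersistent : Form → Set₁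
ValidPersistent φ = (M : Model) → Persistent (Model.frame M) → ∀ w → _⊨_ M w φ

NotValid : Form → Set₁
NotValid φ = Σ Model λ M → ∃[ w ] ¬ (_⊨_ M w φ)

schema1 : Form → Form → Form
schema1 φ ψ = (○ φ ⇒ ○ ψ) ⇒ ○ (φ ⇒ ψ)

schema2 : Form → Form → Form
schema2 φ ψ = (◇ φ ⇒ □ ψ) ⇒ □ (φ ⇒ ψ)

module Submission where

-- Take three worlds a, b, c with
-- b ≼ c the only strict comparison, S a = S b = b, S c = c, and let p hold
-- only at c.  The orbit of a is a, b, b, ... and never meets c, while a
-- has no proper successor; so ○p ⇒ ○⊥ and ◇p ⇒ □⊥ hold vacuously at a.
-- Yet S a = b ⊭ p ⇒ ⊥, since c ≽ b satisfies p.  Hence both schemas fail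
-- at a for φ = p, ψ = ⊥.
--
-- Persistence of S propagates to every
-- iterate S^k ('iter-persistent').  Consequently, to prove S^k w ⊨ φ ⇒ ψ it
-- suffices to prove S^k u ⊨ φ → S^k u ⊨ ψ for all u ≽ w, because every
-- v ≽ S^k w is of the form S^k u ('push-implication').  Schema (1) is the
-- case k = 1; schema (2) applies it for each k, using that φ at S^k u
-- yields ◇φ at u and that □ψ at u yields ψ at S^k u.

open import Defs
open import Data.Product using (_×_; ∃-syntax; _,_)
open import Data.Nat using (ℕ; zero; suc)
open import Data.Empty using (⊥)
open import Relation.Nullary using (¬_)
open import Relation.Binary.PropositionalEquality
  using (_≡_; _≢_; refl; subst; sym; isEquivalence)
open import Relation.Binary.Structures using (IsPartialOrder)

data World : Set where
  a b c : World

data _≤W_ : World → World → Set where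
  ≤W-refl : ∀ {x} → x ≤W x
  b≤c     : b ≤W c

≤W-trans : ∀ {x y z} → x ≤W y → y ≤W z → x ≤W z
≤W-trans ≤W-refl q       = q
≤W-trans b≤c     ≤W-refl = b≤c

≤W-antisym : ∀ {x y} → x ≤W y → y ≤W x → x ≡ y
≤W-antisym ≤W-refl _ = refl
≤W-antisym b≤c     ()

≤W-isPartialOrder : IsPartialOrder _≡_ _≤W_
≤W-isPartialOrder = record
  { isPreorder = record
    { isEquivalence = isEquivalence
    ; reflexive     = λ { refl → ≤W-refl }
    ; trans         = ≤W-trans
    }
  ; antisym = ≤W-antisym
  }

step : World → World
step a = b
step b = b
step c = c

step-mono : ∀ {x y} → x ≤W y → step x ≤W step y
step-mono ≤W-refl = ≤W-refl
step-mono b≤c     = b≤c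

atC : World → ℕ → Set
atC w _ = w ≡ c

atC-mono : ∀ {w v} q → w ≤W v → atC w q → atC v q
atC-mono _ ≤W-refl e = e
atC-mono _ b≤c     ()

counterFrame : DynPoset
counterFrame = record
  { W = World ; inhabit = a ; _≼_ = _≤W_ ; isPO = ≤W-isPartialOrder
  ; S = step ; S-mono = step-mono }

counterModel : Model
counterModel = record { frame = counterFrame ; V = atC ; V-mono = atC-mono }

p : Form
p = var 0

step-reflects-c : ∀ x → step x ≡ c → x ≡ c
step-reflects-c c _ = refl

orbit-a-avoids-c : ∀ k → iter step k a ≢ c
orbit-a-avoids-c zero    ()
orbit-a-avoids-c (suc k) e = orbit-a-avoids-c k (step-reflects-c (iter step k a) e)

¬p-fails-at-b : ¬ (_⊨_ counterModel b (p ⇒ ⊥'))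
¬p-fails-at-b h = h c b≤c refl

schema1-fails : ¬ (_⊨_ counterModel a (schema1 p ⊥'))
schema1-fails h = ¬p-fails-at-b (h a ≤W-refl vacuous)
  where
  vacuous : _⊨_ counterModel a (○ p ⇒ ○ ⊥')
  vacuous .a ≤W-refl ()

schema2-fails : ¬ (_⊨_ counterModel a (schema2 p ⊥'))
schema2-fails h = ¬p-fails-at-b (h a ≤W-refl vacuous 1)
  where
  vacuous : _⊨_ counterModel a (◇ p ⇒ □ ⊥')
  vacuous .a ≤W-refl (k , pAtOrbit) with orbit-a-avoids-c k pAtOrbit
  ... | ()

module _ (N : Model) (persistent : Persistent (Model.frame N)) where
  open Model N

  iter-persistent : ∀ k w v → iter S k w ≼ v → ∃[ u ] (w ≼ u × iter S k u ≡ v)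
  iter-persistent zero    w v w≼v = v , w≼v , refl
  iter-persistent (suc k) w v le with persistent (iter S k w) v le
  ... | u′ , Skw≼u′ , Su′≡v with iter-persistent k w u′ Skw≼u′
  ...   | u , w≼u , Sku≡u′ = u , w≼u , subst (λ z → S z ≡ v) (sym Sku≡u′) Su′≡v

  push-implication : ∀ k φ ψ w
    → (∀ u → w ≼ u → _⊨_ N (iter S k u) φ → _⊨_ N (iter S k u) ψ)
    → _⊨_ N (iter S k w) (φ ⇒ ψ)
  push-implication k φ ψ w pointwise v le vφ with iter-persistent k w v le
  ... | u , w≼u , refl = pointwise u w≼u vφ

  schema1-valid : ∀ φ ψ w → _⊨_ N w (schema1 φ ψ)
  schema1-valid φ ψ w x _ nextImp = push-implication 1 φ ψ x nextImp

  schema2-valid : ∀ φ ψ w → _⊨_ N w (schema2 φ ψ)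
  schema2-valid φ ψ w x _ eventuallyImp k =
    push-implication k φ ψ x (λ u x≼u φAtSku → eventuallyImp u x≼u (k , φAtSku) k)

mainTheorem7 : (∃[ φ ] ∃[ ψ ] NotValid (schema1 φ ψ))
    × (∃[ φ ] ∃[ ψ ] NotValid (schema2 φ ψ))
    × (∀ φ ψ → ValidPersistent (schema1 φ ψ))
    × (∀ φ ψ → ValidPersistent (schema2 φ ψ))
mainTheorem7 =
    (p , ⊥' , counterModel , a , schema1-fails)
  , (p , ⊥' , counterModel , a , schema2-fails)
  , (λ φ ψ N persistent → schema1-valid N persistent φ ψ)
  , (λ φ ψ N persistent → schema2-valid N persistent φ ψ)
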